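{- For every integer $r\ge 2$, $M(2r-1,r)=m_2(C_{2r-1})=1+\frac{1}{2r-3}$.
   Context: $C_\ell$ is the cycle on $\ell$ vertices. The 2-density of a graph $H$ is $m_2(H)=\max\{\frac{e(H')-1}{|H'|-2}: H'\subseteq H,\ |H'|\ge 3\}$. $M(m,r)$ is the minimum of $m_2(H)$ over all graphs $H$ on $m$ vertices with independence number $\alpha(H)\le r-1$. -}

module Defs where

open import Data.Bool using (Bool; true; false; _∧_; _∨_; if_then_else_)
open import Data.Nat as ℕ using (ℕ; zero; suc; _∸_; _≤_)
open import Data.Nat.DivMod using (_%_; m<n⇒m%n≡m; n%n≡0)
open import Data.Nat.Properties using (≤-antisym; ≮⇒≥; 1+n≢n)
open import Data.Bool.Properties using (∨-comm)
open import Data.Fin.Properties using (toℕ<n)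
open import Relation.Nullary using (¬_; yes; no)
open import Data.Empty using (⊥)
open import Data.Fin using (Fin; toℕ)
open import Data.Fin.Subset using (Subset; _∈_; ∣_∣)
open import Data.List using (List; map; allFin)
open import Data.Nat.ListAction using (sum)
open import Data.Integer as ℤ using (ℤ; +_)
open import Data.Rational as ℚ using (ℚ; _/_; 0ℚ)
open import Data.Product using (Σ; _×_; _,_)
open import Relation.Nullary.Decidable using (⌊_⌋)
open import Relation.Binary.PropositionalEquality using (_≡_; refl; trans; cong) renaming (sym to ≡-sym)

record Graph (n : ℕ) : Set where
  field
    adj    : Fin n → Fin n → Bool
    sym    : ∀ i j → adj i j ≡ adj j i
    irrefl : ∀ i → adj i i ≡ false
open Graph public

edgeCount : ∀ {n} → Graph n → ℕ
edgeCount {n} G =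
  sum (map (λ i → sum (map (λ j →
    if ⌊ toℕ i ℕ.<? toℕ j ⌋ ∧ adj G i j then 1 else 0) (allFin n))) (allFin n))

-- a / d as a rational; the value for d = 0 is a dummy and never used below
frac : ℤ → ℕ → ℚ
frac a zero    = 0ℚ
frac a (suc d) = a / suc d

record Subgraph {n : ℕ} (H : Graph n) : Set where
  field
    verts   : Subset n
    sub     : Graph n
    edgeSub : ∀ i j → adj sub i j ≡ true →
              (adj H i j ≡ true) × (i ∈ verts) × (j ∈ verts)
open Subgraph public

density : ∀ {n} {H : Graph n} → Subgraph H → ℚ
density H' = frac (+ edgeCount (sub H') ℤ.- + 1) (∣ verts H' ∣ ∸ 2)

IsM2 : ∀ {n} → Graph n → ℚ → Set
IsM2 H q =
  (Σ (Subgraph H) λ H' → (3 ≤ ∣ verts H' ∣) × (density H' ≡ q)) ×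
  (∀ (H' : Subgraph H) → 3 ≤ ∣ verts H' ∣ → density H' ℚ.≤ q)

Independent : ∀ {n} → Graph n → Subset n → Set
Independent H S = ∀ i j → i ∈ S → j ∈ S → adj H i j ≡ false

AlphaAtMost : ∀ {n} → Graph n → ℕ → Set
AlphaAtMost H k = ∀ S → Independent H S → ∣ S ∣ ≤ k

IsM : ℕ → ℕ → ℚ → Set
IsM m r q =
  (Σ (Graph m) λ H → AlphaAtMost H (r ∸ 1) × IsM2 H q) ×
  (∀ (H : Graph m) → AlphaAtMost H (r ∸ 1) → ∀ q' → IsM2 H q' → q ℚ.≤ q')

-- cycle C_ℓ on Fin ℓ (ℓ ≥ 3): i ~ j iff j ≡ i+1 (mod ℓ) or i ≡ j+1 (mod ℓ).
-- For ℓ < 3 there is no cycle; we put the empty graph there (never used below).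
cycAdj : (ℓ : ℕ) → Fin ℓ → Fin ℓ → Bool
cycAdj (suc (suc (suc k))) i j =
  ⌊ toℕ j ℕ.≟ (suc (toℕ i)) % (3 ℕ.+ k) ⌋ ∨ ⌊ toℕ i ℕ.≟ (suc (toℕ j)) % (3 ℕ.+ k) ⌋
cycAdj _ i j = false

private
  noLoop : ∀ k (i : Fin (3 ℕ.+ k)) → ¬ (toℕ i ≡ suc (toℕ i) % (3 ℕ.+ k))
  noLoop k i eq with suc (toℕ i) ℕ.<? 3 ℕ.+ k
  ... | yes lt = 1+n≢n (≡-sym (trans eq (m<n⇒m%n≡m lt)))
  ... | no nlt with ≤-antisym (toℕ<n i) (≮⇒≥ nlt)
  ... | e with trans eq (trans (cong (_% (3 ℕ.+ k)) e) (n%n≡0 (3 ℕ.+ k)))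
  ... | i0 with () ← trans (≡-sym e) (cong suc i0)

  dfalse : ∀ k (i : Fin (3 ℕ.+ k)) → ⌊ toℕ i ℕ.≟ (suc (toℕ i)) % (3 ℕ.+ k) ⌋ ≡ false
  dfalse k i with toℕ i ℕ.≟ (suc (toℕ i)) % (3 ℕ.+ k)
  ... | yes p with () ← noLoop k i p
  ... | no _ = refl

cycSym : ∀ ℓ i j → cycAdj ℓ i j ≡ cycAdj ℓ j i
cycSym (suc (suc (suc k))) i j =
  ∨-comm ⌊ toℕ j ℕ.≟ (suc (toℕ i)) % (3 ℕ.+ k) ⌋ ⌊ toℕ i ℕ.≟ (suc (toℕ j)) % (3 ℕ.+ k) ⌋
cycSym zero i j = refl
cycSym (suc zero) i j = refl
cycSym (suc (suc zero)) i j = refl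

cycIrr : ∀ ℓ i → cycAdj ℓ i i ≡ false
cycIrr (suc (suc (suc k))) i rewrite dfalse k i = refl
cycIrr zero i = refl
cycIrr (suc zero) i = refl
cycIrr (suc (suc zero)) i = refl

Cycle : (ℓ : ℕ) → Graph ℓ
Cycle ℓ = record { adj = cycAdj ℓ ; sym = cycSym ℓ ; irrefl = cycIrr ℓ }

module Submission where

-- Write ℓ = 2r - 1 = 2t + 3 and ρ = (ℓ-1)/(ℓ-2) = 1 + 1/(ℓ-2).  The theorem is
-- the conjunction of three facts.
--  (1) α(C_ℓ) ≤ t + 1: an independent set S of the cycle is disjoint from its
--      rotation S + 1, so 2|S| ≤ ℓ.
--  (2) m₂(C_ℓ) = ρ: the whole cycle has ℓ edges and density ρ; a subgraph on a
--      proper vertex set has fewer edges than vertices (the vertex set is not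
--      closed under rotation), hence density at most 1.
--  (3) m₂(H) ≥ ρ whenever |H| = ℓ and α(H) ≤ t + 1: greedily, every graph has
--      either an independent set containing half of its vertices or a vertex
--      set T with |T| ≥ 3 spanning at least |T| edges; the first is excluded by
--      α(H) ≤ t + 1 < ℓ/2, and T has density (e-1)/(|T|-2) ≥ (|T|-1)/(|T|-2) ≥ ρ.

open import Defs hiding (sym)

module OddCycles where

  open import Data.Bool using (Bool; true; false; _∧_; _∨_; not; if_then_else_) renaming (_≟_ to _≟ᵇ_)
  open import Data.Bool.Properties using (∧-comm; ¬-not)
  open import Data.Nat as ℕ using (ℕ; zero; suc; _+_; _*_; _∸_; _≤_; _<_; z≤n; s≤s)
  import Data.Nat.Properties as ℕP
  open import Data.Fin as Fin using (Fin; toℕ; inject₁; fromℕ)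
  import Data.Fin.Properties as FinP
  open import Data.Vec as Vec using ([]; _∷_)
  import Data.Vec.Properties as VecP
  open import Data.Fin.Subset using (Subset; _∈_; ∣_∣)
  open import Data.List as List using (map; allFin)
  import Data.List.Properties as ListP
  import Data.Nat.ListAction as ListAction
  open import Data.Fin.Induction using (<-weakInduction; <-weakInduction-startingFrom)
  open import Data.Nat.DivMod using (_%_; _mod_; m%n<n; m<n⇒m%n≡m; n%n≡0)
  open import Data.Product using (Σ; ∃; _×_; _,_; proj₁; proj₂)
  open import Data.Sum using (_⊎_; inj₁; inj₂)
  open import Data.Empty using (⊥; ⊥-elim)
  open import Relation.Nullary using (yes; no)
  open import Relation.Nullary.Decidable using (⌊_⌋; _×-dec_)
  open import Data.Nat.Tactic.RingSolver using (solve-∀)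
  open import Relation.Binary.PropositionalEquality
  open import Algebra.Properties.CommutativeMonoid.Sum ℕP.+-0-commutativeMonoid
    using (sum; sum-syntax; sum-replicate-zero; sum-cong-≗; ∑-distrib-+; ∑-comm; sum-init-last)

  𝟙 : Bool → ℕ
  𝟙 true  = 1
  𝟙 false = 0

  𝟙-∧≤ : ∀ a b → 𝟙 (a ∧ b) ≤ 𝟙 a
  𝟙-∧≤ true  true  = ℕP.≤-refl
  𝟙-∧≤ true  false = z≤n
  𝟙-∧≤ false _     = z≤n

  𝟙-∨ : ∀ x y → 𝟙 (x ∨ y) ≡ 𝟙 (x ∧ not y) + 𝟙 y
  𝟙-∨ true  true  = refl
  𝟙-∨ true  false = refl
  𝟙-∨ false y     = refl

  𝟙-partition : ∀ b x y → x ∧ y ≡ false → 𝟙 (b ∧ not (x ∨ y)) + (𝟙 (x ∧ b) + 𝟙 (y ∧ b)) ≡ 𝟙 b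
  𝟙-partition true  true  true  ()
  𝟙-partition true  true  false _ = refl
  𝟙-partition true  false true  _ = refl
  𝟙-partition true  false false _ = refl
  𝟙-partition false true  true  _ = refl
  𝟙-partition false true  false _ = refl
  𝟙-partition false false true  _ = refl
  𝟙-partition false false false _ = refl

  halve-≤ : ∀ {a b} → a + a ≤ suc (b + b) → a ≤ b
  halve-≤ {a} {b} a+a≤2b+1 with a ℕ.≤? b
  ... | yes a≤b = a≤b
  ... | no  a≰b = ⊥-elim (ℕP.<⇒≱ (ℕP.≤-trans (s≤s (ℕP.≤-reflexive (sym (ℕP.+-suc b b))))
                                    (ℕP.+-mono-≤ (ℕP.≰⇒> a≰b) (ℕP.≰⇒> a≰b))) a+a≤2b+1)

  ∑-mono-≤ : ∀ {n} {f g : Fin n → ℕ} → (∀ i → f i ≤ g i) → sum f ≤ sum g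
  ∑-mono-≤ {zero}  f≤g = z≤n
  ∑-mono-≤ {suc n} f≤g = ℕP.+-mono-≤ (f≤g Fin.zero) (∑-mono-≤ (λ i → f≤g (Fin.suc i)))

  ∑-mono-< : ∀ {n} {f g : Fin n → ℕ} → (∀ i → f i ≤ g i) → ∀ a → f a < g a → sum f < sum g
  ∑-mono-< f≤g Fin.zero    fa<ga = ℕP.+-mono-<-≤ fa<ga (∑-mono-≤ (λ i → f≤g (Fin.suc i)))
  ∑-mono-< f≤g (Fin.suc a) fa<ga = ℕP.+-mono-≤-< (f≤g Fin.zero) (∑-mono-< (λ i → f≤g (Fin.suc i)) a fa<ga)

  ∑-positive : ∀ {n} (f : Fin n → ℕ) → 0 < sum f → ∃ λ i → 0 < f i
  ∑-positive {suc n} f 0<∑ with f Fin.zero in f₀≡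
  ... | suc _ = Fin.zero , subst (0 <_) (sym f₀≡) (s≤s z≤n)
  ... | zero  with ∑-positive (λ i → f (Fin.suc i)) 0<∑
  ...   | i , 0<fi = Fin.suc i , 0<fi

  δ : ∀ {n} → Fin n → Fin n → Bool
  δ a j = ⌊ j FinP.≟ a ⌋

  δ-self : ∀ {n} (a : Fin n) → δ a a ≡ true
  δ-self a with a FinP.≟ a
  ... | yes _   = refl
  ... | no  a≢a = ⊥-elim (a≢a refl)

  ∑-δ : ∀ {n} (a : Fin n) (c : Fin n → Bool) → ∑[ j < n ] 𝟙 (δ a j ∧ c j) ≡ 𝟙 (c a)
  ∑-δ {suc n} Fin.zero c =
    trans (cong (𝟙 (c Fin.zero) +_) (sum-replicate-zero n)) (ℕP.+-identityʳ (𝟙 (c Fin.zero)))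
  ∑-δ {suc n} (Fin.suc a) c = trans (sum-cong-≗ shift) (∑-δ a (λ j → c (Fin.suc j)))
    where
    shift : ∀ j → 𝟙 (⌊ Fin.suc j FinP.≟ Fin.suc a ⌋ ∧ c (Fin.suc j)) ≡ 𝟙 (⌊ j FinP.≟ a ⌋ ∧ c (Fin.suc j))
    shift j with j FinP.≟ a
    ... | yes refl = refl
    ... | no  _    = refl

  listSum-allFin : ∀ {n} (f : Fin n → ℕ) → ListAction.sum (map f (allFin n)) ≡ sum f
  listSum-allFin {n} f = trans (cong ListAction.sum (ListP.map-tabulate (λ i → i) f)) (sum-tabulate f)
    where
    sum-tabulate : ∀ {m} (g : Fin m → ℕ) → ListAction.sum (List.tabulate g) ≡ sum g
    sum-tabulate {zero}  g = refl
    sum-tabulate {suc m} g = cong (g Fin.zero +_) (sum-tabulate (λ i → g (Fin.suc i)))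

  VSet : ℕ → Set
  VSet n = Fin n → Bool

  size : ∀ {n} → VSet n → ℕ
  size {n} s = ∑[ i < n ] 𝟙 (s i)

  ∣∣≡size : ∀ {n} (S : Subset n) → ∣ S ∣ ≡ size (Vec.lookup S)
  ∣∣≡size []          = refl
  ∣∣≡size (true ∷ S)  = cong suc (∣∣≡size S)
  ∣∣≡size (false ∷ S) = ∣∣≡size S

  size-full : ∀ n → size {n} (λ _ → true) ≡ n
  size-full zero    = refl
  size-full (suc n) = cong suc (size-full n)

  size≤n : ∀ {n} (s : VSet n) → size s ≤ n
  size≤n {n} s = ℕP.≤-trans (∑-mono-≤ (λ i → 𝟙≤1 (s i))) (ℕP.≤-reflexive (size-full n))
    where
    𝟙≤1 : ∀ b → 𝟙 b ≤ 1
    𝟙≤1 true  = ℕP.≤-refl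
    𝟙≤1 false = z≤n

  size-nonempty : ∀ {n} (s : VSet n) → 0 < size s → ∃ λ i → s i ≡ true
  size-nonempty s 0<size with ∑-positive (λ i → 𝟙 (s i)) 0<size
  ... | i , 0<𝟙 = i , 𝟙-pos (s i) 0<𝟙
    where
    𝟙-pos : ∀ b → 0 < 𝟙 b → b ≡ true
    𝟙-pos true _ = refl

  edges : ∀ {n} → (Fin n → Fin n → Bool) → ℕ
  edges {n} a = ∑[ i < n ] ∑[ j < n ] 𝟙 (⌊ toℕ i ℕ.<? toℕ j ⌋ ∧ a i j)

  degreeSum : ∀ {n} → (Fin n → Fin n → Bool) → ℕ
  degreeSum {n} a = ∑[ i < n ] ∑[ j < n ] 𝟙 (a i j)

  edgeCount≡edges : ∀ {n} (G : Graph n) → edgeCount G ≡ edges (adj G)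
  edgeCount≡edges {n} G = trans (listSum-allFin row) (sum-cong-≗ λ i →
    trans (listSum-allFin (entry i)) (sum-cong-≗ λ j → if-𝟙 (⌊ toℕ i ℕ.<? toℕ j ⌋ ∧ adj G i j)))
    where
    entry : Fin n → Fin n → ℕ
    entry i j = if ⌊ toℕ i ℕ.<? toℕ j ⌋ ∧ adj G i j then 1 else 0
    row : Fin n → ℕ
    row i = ListAction.sum (map (entry i) (allFin n))
    if-𝟙 : ∀ b → (if b then 1 else 0) ≡ 𝟙 b
    if-𝟙 true  = refl
    if-𝟙 false = refl

  handshake : ∀ {n} (G : Graph n) → degreeSum (adj G) ≡ edges (adj G) + edges (adj G)
  handshake {n} G = begin
    degreeSum a
      ≡⟨ sum-cong-≗ (λ i → trans (sum-cong-≗ (split i)) (∑-distrib-+ (below i) (λ j → below j i))) ⟩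
    ∑[ i < n ] (∑[ j < n ] below i j + ∑[ j < n ] below j i)
      ≡⟨ ∑-distrib-+ (λ i → ∑[ j < n ] below i j) (λ i → ∑[ j < n ] below j i) ⟩
    edges a + ∑[ i < n ] ∑[ j < n ] below j i      ≡⟨ cong (edges a +_) (∑-comm (λ i j → below j i)) ⟩
    edges a + edges a                              ∎
    where
    open ≡-Reasoning
    a = adj G
    below : Fin n → Fin n → ℕ
    below i j = 𝟙 (⌊ toℕ i ℕ.<? toℕ j ⌋ ∧ a i j)
    split : ∀ i j → 𝟙 (a i j) ≡ below i j + below j i
    split i j with toℕ i ℕ.<? toℕ j | toℕ j ℕ.<? toℕ i
    ... | yes i<j | yes j<i = ⊥-elim (ℕP.<-asym i<j j<i)
    ... | yes _   | no _    = sym (ℕP.+-identityʳ _)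
    ... | no _    | yes _   = cong 𝟙 (Graph.sym G i j)
    ... | no i≮j  | no j≮i with FinP.toℕ-injective (ℕP.≤-antisym (ℕP.≮⇒≥ j≮i) (ℕP.≮⇒≥ i≮j))
    ...   | refl rewrite irrefl G i = refl

  induced : ∀ {n} → Graph n → VSet n → Graph n
  induced G s = record
    { adj    = λ i j → adj G i j ∧ (s i ∧ s j)
    ; sym    = λ i j → cong₂ _∧_ (Graph.sym G i j) (∧-comm (s i) (s j))
    ; irrefl = λ i → cong (_∧ (s i ∧ s i)) (irrefl G i)
    }

  inducedSubgraph : ∀ {n} (G : Graph n) → VSet n → Subgraph G
  inducedSubgraph {n} G s = record { verts = Vec.tabulate s ; sub = induced G s ; edgeSub = edge-in }
    where
    ∈-tabulate : ∀ {i} → s i ≡ true → i ∈ Vec.tabulate s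
    ∈-tabulate {i} si = VecP.lookup⇒[]= i (Vec.tabulate s) (trans (VecP.lookup∘tabulate s i) si)
    edge-in : ∀ i j → adj (induced G s) i j ≡ true → (adj G i j ≡ true) × (i ∈ Vec.tabulate s) × (j ∈ Vec.tabulate s)
    edge-in i j e with adj G i j | s i in si | s j in sj
    ... | true | true | true = refl , ∈-tabulate si , ∈-tabulate sj

  ∣tabulate∣ : ∀ {n} (s : VSet n) → ∣ Vec.tabulate s ∣ ≡ size s
  ∣tabulate∣ s = trans (∣∣≡size (Vec.tabulate s)) (sum-cong-≗ (λ i → cong 𝟙 (VecP.lookup∘tabulate s i)))

  subgraph-edges≤ : ∀ {n} {G : Graph n} (H′ : Subgraph G) →
    edgeCount (sub H′) ≤ edges (adj (induced G (Vec.lookup (verts H′))))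
  subgraph-edges≤ {n} {G} H′ = ℕP.≤-trans (ℕP.≤-reflexive (edgeCount≡edges (sub H′)))
    (∑-mono-≤ λ i → ∑-mono-≤ λ j → 𝟙-∧-mono ⌊ toℕ i ℕ.<? toℕ j ⌋ (edge-induced i j))
    where
    S = verts H′
    edge-induced : ∀ i j → adj (sub H′) i j ≡ true → adj (induced G (Vec.lookup S)) i j ≡ true
    edge-induced i j e with edgeSub H′ i j e
    ... | Gij , i∈S , j∈S rewrite Gij | VecP.[]=⇒lookup i∈S | VecP.[]=⇒lookup j∈S = refl
    𝟙-∧-mono : ∀ c {a b} → (a ≡ true → b ≡ true) → 𝟙 (c ∧ a) ≤ 𝟙 (c ∧ b)
    𝟙-∧-mono false        a⇒b = z≤n
    𝟙-∧-mono true {false} a⇒b = z≤n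
    𝟙-∧-mono true {true}  a⇒b rewrite a⇒b refl = ℕP.≤-refl

  rot : ∀ {n} → Fin (suc n) → Fin (suc n)
  rot {n} i = suc (toℕ i) mod suc n

  toℕ-rot : ∀ {n} (i : Fin (suc n)) → toℕ (rot i) ≡ suc (toℕ i) % suc n
  toℕ-rot {n} i = FinP.toℕ-fromℕ< (m%n<n (suc (toℕ i)) (suc n))

  rot-inject₁ : ∀ {n} (j : Fin n) → rot (inject₁ j) ≡ Fin.suc j
  rot-inject₁ {n} j = FinP.toℕ-injective (begin
    toℕ (rot (inject₁ j))          ≡⟨ toℕ-rot (inject₁ j) ⟩
    suc (toℕ (inject₁ j)) % suc n  ≡⟨ cong (λ x → suc x % suc n) (FinP.toℕ-inject₁ j) ⟩
    suc (toℕ j) % suc n            ≡⟨ m<n⇒m%n≡m (s≤s (FinP.toℕ<n j)) ⟩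
    suc (toℕ j)                    ∎)
    where open ≡-Reasoning

  rot-last : ∀ n → rot (fromℕ n) ≡ Fin.zero
  rot-last n = FinP.toℕ-injective (begin
    toℕ (rot (fromℕ n))       ≡⟨ toℕ-rot (fromℕ n) ⟩
    suc (toℕ (fromℕ n)) % suc n ≡⟨ cong (λ x → suc x % suc n) (FinP.toℕ-fromℕ n) ⟩
    suc n % suc n             ≡⟨ n%n≡0 (suc n) ⟩
    0                         ∎)
    where open ≡-Reasoning

  toℕ-rot-cases : ∀ {n} (i : Fin (suc n)) →
    (toℕ (rot i) ≡ suc (toℕ i)) ⊎ (toℕ i ≡ n × toℕ (rot i) ≡ 0)
  toℕ-rot-cases {n} i with suc (toℕ i) ℕ.<? suc n
  ... | yes i+1<n+1 = inj₁ (trans (toℕ-rot i) (m<n⇒m%n≡m i+1<n+1))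
  ... | no  i+1≮n+1 = inj₂ (i≡n , trans (toℕ-rot i) (trans (cong (λ x → suc x % suc n) i≡n) (n%n≡0 (suc n))))
    where
    i≡n : toℕ i ≡ n
    i≡n = ℕP.≤-antisym (ℕ.s≤s⁻¹ (FinP.toℕ<n i)) (ℕ.s≤s⁻¹ (ℕP.≮⇒≥ i+1≮n+1))

  -- On a cycle of length at least 3, rotating twice never returns to the start:
  -- compare positions, using that the last position n is at least 2.
  rot²≢id : ∀ k (i : Fin (3 + k)) → rot (rot i) ≢ i
  rot²≢id k i rot²i≡i with toℕ-rot-cases i | toℕ-rot-cases (rot i) | cong toℕ rot²i≡i
  -- positions i, i + 1, i + 2
  ... | inj₁ r≡i+1 | inj₁ r²≡r+1 | r²≡i =
    ℕP.m≢1+n+m (toℕ i) (trans (sym r²≡i) (trans r²≡r+1 (cong suc r≡i+1)))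
  -- positions i, i + 1 = n, 0 = i, so n = 1
  ... | inj₁ r≡i+1 | inj₂ (r≡n , r²≡0) | r²≡i
    with () ← trans (sym r≡n) (trans r≡i+1 (cong suc (trans (sym r²≡i) r²≡0)))
  -- positions i = n, 0, 1 = i, so n = 1
  ... | inj₂ (i≡n , r≡0) | inj₁ r²≡r+1 | r²≡i
    with () ← trans (sym i≡n) (trans (sym r²≡i) (trans r²≡r+1 (cong suc r≡0)))
  -- positions n, 0 = n
  ... | inj₂ (_ , r≡0) | inj₂ (r≡n , _) | _ with () ← trans (sym r≡n) r≡0

  ∑-rot : ∀ {n} (f : Fin (suc n) → ℕ) → sum (λ i → f (rot i)) ≡ sum f
  ∑-rot {n} f = begin
    sum (λ i → f (rot i))
      ≡⟨ sum-init-last (λ i → f (rot i)) ⟩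
    sum (λ i → f (rot (inject₁ i))) + f (rot (fromℕ n))
      ≡⟨ cong₂ _+_ (sum-cong-≗ (λ i → cong f (rot-inject₁ i))) (cong f (rot-last n)) ⟩
    sum (λ i → f (Fin.suc i)) + f Fin.zero
      ≡⟨ ℕP.+-comm (sum (λ i → f (Fin.suc i))) (f Fin.zero) ⟩
    sum f
      ∎
    where open ≡-Reasoning

  rot-closed⇒full : ∀ {n} (s : VSet (suc n)) → (∀ i → s i ≡ true → s (rot i) ≡ true) →
    ∀ i₀ → s i₀ ≡ true → ∀ j → s j ≡ true
  rot-closed⇒full {n} s closed i₀ si₀ = <-weakInduction (λ j → s j ≡ true) s₀ step
    where
    step : ∀ j → s (inject₁ j) ≡ true → s (Fin.suc j) ≡ true
    step j sj = subst (λ x → s x ≡ true) (rot-inject₁ j) (closed (inject₁ j) sj)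
    sₙ : s (fromℕ n) ≡ true
    sₙ = <-weakInduction-startingFrom (λ j → s j ≡ true) si₀ step (FinP.≤fromℕ i₀)
    s₀ : s Fin.zero ≡ true
    s₀ = subst (λ x → s x ≡ true) (rot-last n) (closed (fromℕ n) sₙ)

  ≟-toℕ : ∀ {n} (x y : Fin n) {v} → toℕ y ≡ v → ⌊ toℕ x ℕ.≟ v ⌋ ≡ ⌊ x FinP.≟ y ⌋
  ≟-toℕ x y refl with toℕ x ℕ.≟ toℕ y | x FinP.≟ y
  ... | yes _   | yes _    = refl
  ... | yes x≡y | no  x≢y  = ⊥-elim (x≢y (FinP.toℕ-injective x≡y))
  ... | no  x≢y | yes refl = ⊥-elim (x≢y refl)
  ... | no  _   | no  _    = refl

  cycAdj-rot : ∀ k (i j : Fin (3 + k)) → cycAdj (3 + k) i j ≡ (δ (rot i) j ∨ δ (rot j) i)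
  cycAdj-rot k i j = cong₂ _∨_ (≟-toℕ j (rot i) (toℕ-rot i)) (≟-toℕ i (rot j) (toℕ-rot j))

  rot-adjacent : ∀ k (i : Fin (3 + k)) → cycAdj (3 + k) i (rot i) ≡ true
  rot-adjacent k i = trans (cycAdj-rot k i (rot i)) (cong (_∨ δ (rot (rot i)) i) (δ-self (rot i)))

  consecutive : ∀ {n} → VSet (suc n) → ℕ
  consecutive {n} s = ∑[ i < suc n ] 𝟙 (s i ∧ s (rot i))

  cycle-edges : ∀ k (s : VSet (3 + k)) → edges (adj (induced (Cycle (3 + k)) s)) ≡ consecutive s
  cycle-edges k s = double-injective (trans (sym (handshake (induced (Cycle (3 + k)) s))) degrees)
    where
    open ≡-Reasoning
    ℓ = 3 + k
    forward backward : Fin ℓ → Fin ℓ → ℕ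
    forward  i j = 𝟙 (δ (rot i) j ∧ (s i ∧ s j))
    backward i j = 𝟙 (δ (rot j) i ∧ (s i ∧ s j))

    -- the two neighbours rot i and rot⁻¹ i of a vertex i are distinct
    split : ∀ i j → 𝟙 (cycAdj ℓ i j ∧ (s i ∧ s j)) ≡ forward i j + backward i j
    split i j rewrite cycAdj-rot k i j with j FinP.≟ rot i | i FinP.≟ rot j
    ... | yes refl | yes i≡rot²i = ⊥-elim (rot²≢id k i (sym i≡rot²i))
    ... | yes _    | no  _       = sym (ℕP.+-identityʳ _)
    ... | no  _    | yes _       = refl
    ... | no  _    | no  _       = refl

    degrees : degreeSum (adj (induced (Cycle ℓ) s)) ≡ consecutive s + consecutive s
    degrees = begin
      ∑[ i < ℓ ] ∑[ j < ℓ ] 𝟙 (cycAdj ℓ i j ∧ (s i ∧ s j))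
        ≡⟨ sum-cong-≗ (λ i → trans (sum-cong-≗ (split i)) (∑-distrib-+ (forward i) (backward i))) ⟩
      ∑[ i < ℓ ] (∑[ j < ℓ ] forward i j + ∑[ j < ℓ ] backward i j)
        ≡⟨ ∑-distrib-+ (λ i → ∑[ j < ℓ ] forward i j) (λ i → ∑[ j < ℓ ] backward i j) ⟩
      ∑[ i < ℓ ] ∑[ j < ℓ ] forward i j + ∑[ i < ℓ ] ∑[ j < ℓ ] backward i j
        ≡⟨ cong (∑[ i < ℓ ] ∑[ j < ℓ ] forward i j +_) (∑-comm backward) ⟩
      ∑[ i < ℓ ] ∑[ j < ℓ ] forward i j + ∑[ j < ℓ ] ∑[ i < ℓ ] backward i j
        ≡⟨ cong₂ _+_ (sum-cong-≗ (λ i → ∑-δ (rot i) (λ j → s i ∧ s j)))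
                     (sum-cong-≗ (λ j → trans (∑-δ (rot j) (λ i → s i ∧ s j)) (cong 𝟙 (∧-comm (s (rot j)) (s j))))) ⟩
      consecutive s + consecutive s
        ∎

    double-injective : ∀ {a b} → a + a ≡ b + b → a ≡ b
    double-injective {zero}  {zero}  _ = refl
    double-injective {suc a} {suc b} eq rewrite ℕP.+-suc a a | ℕP.+-suc b b =
      cong suc (double-injective (ℕP.suc-injective (ℕP.suc-injective eq)))

  -- Each consecutive pair inside s is charged to its first vertex ...
  consecutive≤size : ∀ {n} (s : VSet (suc n)) → consecutive s ≤ size s
  consecutive≤size s = ∑-mono-≤ (λ i → 𝟙-∧≤ (s i) (s (rot i)))

  -- ... and if s is a nonempty proper subset, some vertex of s is not charged,
  -- since otherwise s would be closed under rotation.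
  consecutive<size : ∀ {n} (s : VSet (suc n)) → ∀ i₀ → s i₀ ≡ true → ∀ j → s j ≡ false →
    consecutive s < size s
  consecutive<size s i₀ si₀ j sj with FinP.any? (λ i → s i ∧ not (s (rot i)) ≟ᵇ true)
  ... | yes (i , exit) = ∑-mono-< (λ i → 𝟙-∧≤ (s i) (s (rot i))) i (exit-< (s i) (s (rot i)) exit)
    where
    exit-< : ∀ a b → (a ∧ not b) ≡ true → 𝟙 (a ∧ b) < 𝟙 a
    exit-< true false _ = s≤s z≤n
  ... | no no-exit with trans (sym (rot-closed⇒full s closed i₀ si₀ j)) sj
    where
    closed : ∀ i → s i ≡ true → s (rot i) ≡ true
    closed i si with s (rot i) in eq
    ... | true  = refl
    ... | false = ⊥-elim (no-exit (i , trans (cong (λ x → x ∧ not (s (rot i))) si) (cong not eq)))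
  ...   | ()

  no-consecutive-size : ∀ {n} (s : VSet (suc n)) → (∀ i → s i ≡ true → s (rot i) ≡ true → ⊥) →
    size s + size s ≤ suc n
  no-consecutive-size {n} s apart = begin
    size s + size s                           ≡⟨ cong (size s +_) (sym (∑-rot (λ i → 𝟙 (s i)))) ⟩
    size s + ∑[ i < suc n ] 𝟙 (s (rot i))     ≡⟨ sym (∑-distrib-+ (λ i → 𝟙 (s i)) (λ i → 𝟙 (s (rot i)))) ⟩
    ∑[ i < suc n ] (𝟙 (s i) + 𝟙 (s (rot i))) ≤⟨ ∑-mono-≤ at-most-one ⟩
    size {suc n} (λ _ → true)                 ≡⟨ size-full (suc n) ⟩
    suc n                                     ∎
    where
    open ℕP.≤-Reasoning
    at-most-one : ∀ i → 𝟙 (s i) + 𝟙 (s (rot i)) ≤ 1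
    at-most-one i with s i in si | s (rot i) in sri
    ... | true  | true  = ⊥-elim (apart i si sri)
    ... | true  | false = ℕP.≤-refl
    ... | false | true  = ℕP.≤-refl
    ... | false | false = z≤n

  -- Greedy proof: while some vertex v of the current set s has at most
  -- one neighbour in s, put v into the independent set and delete v together with
  -- its neighbours (at most two vertices); if no such vertex exists, s itself has
  -- minimum degree two and hence at least as many edges as vertices.
  module Greedy {n : ℕ} (H : Graph n) where

    degIn : VSet n → Fin n → ℕ
    degIn s v = ∑[ j < n ] 𝟙 (adj H v j ∧ s j)

    Stable : VSet n → Set
    Stable I = ∀ i j → I i ≡ true → I j ≡ true → adj H i j ≡ false

    Dense : Set
    Dense = Σ (VSet n) λ t → 3 ≤ size t × size t ≤ edges (adj (induced H t))

    LargeStable : VSet n → Set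
    LargeStable s = Σ (VSet n) λ I → Stable I × (∀ i → I i ≡ true → s i ≡ true) × size s ≤ size I + size I

    removeNbhd : VSet n → Fin n → VSet n
    removeNbhd s v j = s j ∧ not (δ v j ∨ adj H v j)

    size-removeNbhd : ∀ s v → s v ≡ true → size (removeNbhd s v) + suc (degIn s v) ≡ size s
    size-removeNbhd s v sv = begin
      size s′ + suc (degIn s v)
        ≡⟨ cong (λ x → size s′ + (x + degIn s v)) (sym (trans (∑-δ v s) (cong 𝟙 sv))) ⟩
      size s′ + (∑[ j < n ] 𝟙 (δ v j ∧ s j) + degIn s v)
        ≡⟨ cong (size s′ +_) (sym (∑-distrib-+ (λ j → 𝟙 (δ v j ∧ s j)) (λ j → 𝟙 (adj H v j ∧ s j)))) ⟩
      size s′ + ∑[ j < n ] (𝟙 (δ v j ∧ s j) + 𝟙 (adj H v j ∧ s j))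
        ≡⟨ sym (∑-distrib-+ (λ j → 𝟙 (s′ j)) (λ j → 𝟙 (δ v j ∧ s j) + 𝟙 (adj H v j ∧ s j))) ⟩
      ∑[ j < n ] (𝟙 (s′ j) + (𝟙 (δ v j ∧ s j) + 𝟙 (adj H v j ∧ s j)))
        ≡⟨ sum-cong-≗ (λ j → 𝟙-partition (s j) (δ v j) (adj H v j) (no-loop j)) ⟩
      size s
        ∎
      where
      open ≡-Reasoning
      s′ = removeNbhd s v
      no-loop : ∀ j → δ v j ∧ adj H v j ≡ false
      no-loop j with j FinP.≟ v
      ... | yes refl = irrefl H j
      ... | no  _    = refl

    insert : Fin n → VSet n → VSet n
    insert v I j = δ v j ∨ I j

    size-insert : ∀ v I → I v ≡ false → size (insert v I) ≡ suc (size I)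
    size-insert v I Iv = begin
      size (insert v I)
        ≡⟨ sum-cong-≗ (λ j → 𝟙-∨ (δ v j) (I j)) ⟩
      ∑[ j < n ] (𝟙 (δ v j ∧ not (I j)) + 𝟙 (I j))
        ≡⟨ ∑-distrib-+ (λ j → 𝟙 (δ v j ∧ not (I j))) (λ j → 𝟙 (I j)) ⟩
      ∑[ j < n ] 𝟙 (δ v j ∧ not (I j)) + size I
        ≡⟨ cong (_+ size I) (trans (∑-δ v (λ j → not (I j))) (cong (λ b → 𝟙 (not b)) Iv)) ⟩
      suc (size I)
        ∎
      where open ≡-Reasoning

    empty-stable : ∀ s → size s ≡ 0 → LargeStable s
    empty-stable s size≡0 = (λ _ → false) , (λ _ _ ()) , (λ _ ()) ,
      ℕP.≤-reflexive (trans size≡0 (sym (cong₂ _+_ (sum-replicate-zero n) (sum-replicate-zero n))))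

    -- Minimum degree two: the degree sum is at least twice the size, and by the
    -- handshake lemma it is twice the number of edges.
    min-degree-2⇒dense : ∀ s → (∀ v → s v ≡ true → 2 ≤ degIn s v) → ∀ v → s v ≡ true → Dense
    min-degree-2⇒dense s deg≥2 v sv = s , three-vertices , halve-≤ (ℕP.m≤n⇒m≤1+n (begin
      size s + size s                              ≡⟨ sym (∑-distrib-+ (λ i → 𝟙 (s i)) (λ i → 𝟙 (s i))) ⟩
      ∑[ i < n ] (𝟙 (s i) + 𝟙 (s i))               ≤⟨ ∑-mono-≤ twice≤degree ⟩
      degreeSum (adj (induced H s))                ≡⟨ handshake (induced H s) ⟩
      edges (adj (induced H s)) + edges (adj (induced H s)) ∎))
      where
      open ℕP.≤-Reasoning
      three-vertices : 3 ≤ size s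
      three-vertices = ℕP.≤-trans (s≤s (deg≥2 v sv))
        (ℕP.≤-trans (ℕP.m≤n+m (suc (degIn s v)) (size (removeNbhd s v))) (ℕP.≤-reflexive (size-removeNbhd s v sv)))
      twice≤degree : ∀ i → 𝟙 (s i) + 𝟙 (s i) ≤ ∑[ j < n ] 𝟙 (adj H i j ∧ (s i ∧ s j))
      twice≤degree i with s i in si
      ... | true  = deg≥2 i si
      ... | false = z≤n

    extend-stable : ∀ s v → s v ≡ true → degIn s v ≤ 1 → LargeStable (removeNbhd s v) → LargeStable s
    extend-stable s v sv deg≤1 (I , stable , I⊆ , large) = insert v I , stable′ , I′⊆s , large′
      where
      rest : ∀ i → I i ≡ true → (s i ≡ true) × (δ v i ≡ false) × (adj H v i ≡ false)
      rest i Ii with I⊆ i Ii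
      ... | i∈removeNbhd with s i | δ v i | adj H v i
      ...   | true | false | false = refl , refl , refl
      v∉I : I v ≡ false
      v∉I with I v in Iv
      ... | true  with () ← trans (sym (δ-self v)) (proj₁ (proj₂ (rest v Iv)))
      ... | false = refl
      in-insert : ∀ i → insert v I i ≡ true → (i ≡ v) ⊎ (I i ≡ true)
      in-insert i Ii with i FinP.≟ v | I i
      ... | yes i≡v | _    = inj₁ i≡v
      ... | no  _   | true = inj₂ refl
      stable′ : Stable (insert v I)
      stable′ i j Ii Ij with in-insert i Ii | in-insert j Ij
      ... | inj₁ refl | inj₁ refl = irrefl H i
      ... | inj₁ refl | inj₂ Ij′  = proj₂ (proj₂ (rest j Ij′))
      ... | inj₂ Ii′  | inj₁ refl = trans (Graph.sym H i j) (proj₂ (proj₂ (rest i Ii′)))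
      ... | inj₂ Ii′  | inj₂ Ij′  = stable i j Ii′ Ij′
      I′⊆s : ∀ i → insert v I i ≡ true → s i ≡ true
      I′⊆s i Ii with in-insert i Ii
      ... | inj₁ refl = sv
      ... | inj₂ Ii′  = proj₁ (rest i Ii′)
      large′ : size s ≤ size (insert v I) + size (insert v I)
      large′ = begin
        size s                                     ≡⟨ sym (size-removeNbhd s v sv) ⟩
        size (removeNbhd s v) + suc (degIn s v)    ≤⟨ ℕP.+-mono-≤ large (s≤s deg≤1) ⟩
        (size I + size I) + 2                      ≡⟨ rearrange (size I) ⟩
        suc (size I) + suc (size I)                ≡⟨ sym (cong₂ _+_ (size-insert v I v∉I) (size-insert v I v∉I)) ⟩
        size (insert v I) + size (insert v I)      ∎
        where
        open ℕP.≤-Reasoning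
        rearrange : ∀ a → (a + a) + 2 ≡ suc a + suc a
        rearrange = solve-∀

    greedy : ∀ bound s → size s ≤ bound → Dense ⊎ LargeStable s
    greedy bound s size≤ with FinP.any? (λ v → (s v ≟ᵇ true) ×-dec (degIn s v ℕ.≤? 1))
    greedy zero s size≤0 | _ = inj₂ (empty-stable s (ℕP.n≤0⇒n≡0 size≤0))
    greedy (suc bound) s size≤ | yes (v , sv , deg≤1) with greedy bound (removeNbhd s v) smaller
      where
      smaller : size (removeNbhd s v) ≤ bound
      smaller = ℕ.s≤s⁻¹ (ℕP.≤-trans (ℕP.≤-trans (s≤s (ℕP.m≤m+n _ (degIn s v)))
        (ℕP.≤-reflexive (trans (sym (ℕP.+-suc _ _)) (size-removeNbhd s v sv)))) size≤)
    ... | inj₁ dense = inj₁ dense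
    ... | inj₂ large = inj₂ (extend-stable s v sv deg≤1 large)
    greedy (suc bound) s size≤ | no no-low-degree with size s ℕ.≟ 0
    ... | yes size≡0 = inj₂ (empty-stable s size≡0)
    ... | no  size≢0 with size-nonempty s (ℕP.n≢0⇒n>0 size≢0)
    ...   | v , sv = inj₁ (min-degree-2⇒dense s deg≥2 v sv)
      where
      deg≥2 : ∀ u → s u ≡ true → 2 ≤ degIn s u
      deg≥2 u su with degIn s u ℕ.≤? 1
      ... | yes deg≤1 = ⊥-elim (no-low-degree (u , su , deg≤1))
      ... | no  deg≰1 = ℕP.≰⇒> deg≰1

  stable-size≤ : ∀ {n} (H : Graph n) {a} → AlphaAtMost H a → ∀ I → Greedy.Stable H I → size I ≤ a
  stable-size≤ H {a} α I stable =
    subst (_≤ a) (∣tabulate∣ I) (α (Vec.tabulate I) (λ i j i∈ j∈ → stable i j (∈⇒true i∈) (∈⇒true j∈)))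
    where
    ∈⇒true : ∀ {i} → i ∈ Vec.tabulate I → I i ≡ true
    ∈⇒true {i} i∈ = trans (sym (VecP.lookup∘tabulate I i)) (VecP.[]=⇒lookup i∈)

  open import Data.Integer as ℤ using (ℤ; +_)
  import Data.Integer.Properties as ℤP
  open import Data.Rational as ℚ using (ℚ; _/_; 1ℚ)
  import Data.Rational.Properties as ℚP
  open import Data.Rational.Unnormalised as ℚᵘ using (mkℚᵘ; *≡*; *≤*)
  import Data.Rational.Unnormalised.Properties as ℚᵘP

  frac-≤ : ∀ (a b : ℤ) d D → a ℤ.* + suc D ℤ.≤ b ℤ.* + suc d → frac a (suc d) ℚ.≤ frac b (suc D)
  frac-≤ a b d D ad≤bD = ℚP.toℚᵘ-cancel-≤
    (ℚᵘP.≤-respˡ-≃ (ℚᵘP.≃-sym (ℚP.toℚᵘ-fromℚᵘ (mkℚᵘ a d)))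
    (ℚᵘP.≤-respʳ-≃ (ℚᵘP.≃-sym (ℚP.toℚᵘ-fromℚᵘ (mkℚᵘ b D))) (*≤* ad≤bD)))

  frac-≤-ℕ : ∀ a b d D → a * suc D ≤ b * suc d → frac (+ a) (suc d) ℚ.≤ frac (+ b) (suc D)
  frac-≤-ℕ a b d D aD≤bd =
    frac-≤ (+ a) (+ b) d D (subst₂ ℤ._≤_ (ℤP.pos-* a (suc D)) (ℤP.pos-* b (suc d)) (ℤ.+≤+ aD≤bd))

  density≤pred : ∀ e d → frac (+ e ℤ.- + 1) (suc d) ℚ.≤ frac (+ (e ∸ 1)) (suc d)
  density≤pred e d = frac-≤ (+ e ℤ.- + 1) (+ (e ∸ 1)) d d (ℤP.*-monoʳ-≤-nonNeg (+ suc d) (pred-≤ e))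
    where
    pred-≤ : ∀ e → + e ℤ.- + 1 ℤ.≤ + (e ∸ 1)
    pred-≤ zero    = ℤ.-≤+
    pred-≤ (suc e) = ℤP.≤-refl

  -- m₂(C_ℓ) = 1 + 1/(ℓ-2) = (ℓ-1)/(ℓ-2), written with ℓ = k + 3.
  cycleRatio : ℕ → ℚ
  cycleRatio k = frac (+ (2 + k)) (suc k)

  1+1/[k+1]≡cycleRatio : ∀ k → 1ℚ ℚ.+ frac (+ 1) (suc k) ≡ cycleRatio k
  1+1/[k+1]≡cycleRatio k = ℚP.toℚᵘ-injective (ℚᵘP.≃-trans (ℚP.toℚᵘ-homo-+ 1ℚ (+ 1 / suc k))
    (ℚᵘP.≃-trans (ℚᵘP.+-cong {ℚ.toℚᵘ 1ℚ} {ℚᵘ.1ℚᵘ} ℚᵘP.≃-refl (ℚP.toℚᵘ-fromℚᵘ (mkℚᵘ (+ 1) k)))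
    (ℚᵘP.≃-trans (*≡* (cong +_ (cross k))) (ℚᵘP.≃-sym (ℚP.toℚᵘ-fromℚᵘ (mkℚᵘ (+ (2 + k)) k))))))
    where
    -- (k+2)·(k+1) = (k+2)·(k+1), unfolded as ℚᵘ addition and *≡* present it
    cross : ∀ k → suc (k + (k + 0 + 1) * suc k) ≡ suc (k + 0 + suc (k + 0 + k * suc (k + 0)))
    cross = solve-∀

  -- Upper bounds for the density (e - 1)/(v - 2) of a subgraph of C_{k+3} with
  -- v vertices and e edges: a spanning subgraph has e ≤ k + 3, and a proper
  -- subgraph is a forest with e < v, hence density at most 1.
  spanning-density≤ : ∀ k e → e ≤ 3 + k → frac (+ e ℤ.- + 1) (3 + k ∸ 2) ℚ.≤ cycleRatio k
  spanning-density≤ k e e≤ℓ = ℚP.≤-trans (density≤pred e k)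
    (frac-≤-ℕ (e ∸ 1) (2 + k) k k (ℕP.*-monoˡ-≤ (suc k) (ℕP.∸-monoˡ-≤ 1 e≤ℓ)))

  forest-density≤ : ∀ k v e → 3 ≤ v → v ≤ 3 + k → e < v → frac (+ e ℤ.- + 1) (v ∸ 2) ℚ.≤ cycleRatio k
  forest-density≤ k (suc (suc (suc w))) e (s≤s (s≤s (s≤s _))) v≤ℓ e<v =
    ℚP.≤-trans (density≤pred e w) (frac-≤-ℕ (e ∸ 1) (2 + k) w k (begin
      (e ∸ 1) * suc k     ≤⟨ ℕP.*-monoˡ-≤ (suc k) (ℕP.∸-monoˡ-≤ 1 (ℕ.s≤s⁻¹ e<v)) ⟩
      suc w * suc k       ≡⟨ ℕP.*-comm (suc w) (suc k) ⟩
      suc k * suc w       ≤⟨ ℕP.*-monoˡ-≤ (suc w) (ℕP.n≤1+n (suc k)) ⟩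
      (2 + k) * suc w     ∎))
    where open ℕP.≤-Reasoning

  -- Lower bound: a graph on 3 ≤ v ≤ k + 3 vertices with e ≥ v edges has
  -- density (e-1)/(v-2) ≥ (v-1)/(v-2) ≥ (k+2)/(k+1).
  dense-density≥ : ∀ k v e → 3 ≤ v → v ≤ 3 + k → v ≤ e → cycleRatio k ℚ.≤ frac (+ e ℤ.- + 1) (v ∸ 2)
  dense-density≥ k (suc (suc (suc w))) (suc e) (s≤s (s≤s (s≤s _))) v≤ℓ v≤e = frac-≤-ℕ (2 + k) e k w (begin
    (2 + k) * suc w     ≤⟨ shrinking-ratio (ℕ.s≤s⁻¹ (ℕ.s≤s⁻¹ (ℕ.s≤s⁻¹ v≤ℓ))) ⟩
    (2 + w) * suc k     ≤⟨ ℕP.*-monoˡ-≤ (suc k) (ℕ.s≤s⁻¹ v≤e) ⟩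
    e * suc k           ∎)
    where
    open ℕP.≤-Reasoning
    -- (v-1)/(v-2) decreases in v
    shrinking-ratio : ∀ {w k} → w ≤ k → (2 + k) * suc w ≤ (2 + w) * suc k
    shrinking-ratio {w} {k} w≤k with ℕP.m≤n⇒∃[o]m+o≡n w≤k
    ... | c , refl = subst₂ _≤_ (sym (lhs w c)) (sym (rhs w c))
      (ℕP.+-monoʳ-≤ ((2 + w) * suc w) (ℕP.*-monoʳ-≤ c (ℕP.n≤1+n (suc w))))
      where
      lhs : ∀ w c → (2 + (w + c)) * suc w ≡ (2 + w) * suc w + c * suc w
      lhs = solve-∀
      rhs : ∀ w c → (2 + w) * suc (w + c) ≡ (2 + w) * suc w + c * suc (suc w)
      rhs = solve-∀

  density-induced : ∀ {n} (G : Graph n) (s : VSet n) →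
    density (inducedSubgraph G s) ≡ frac (+ edges (adj (induced G s)) ℤ.- + 1) (size s ∸ 2)
  density-induced G s =
    cong₂ (λ e v → frac (+ e ℤ.- + 1) (v ∸ 2)) (edgeCount≡edges (induced G s)) (∣tabulate∣ s)

  -- α(C_{2t+3}) ≤ t + 1: an independent set contains no two consecutive vertices.
  cycle-α : ∀ t → AlphaAtMost (Cycle (3 + (t + t))) (suc t)
  cycle-α t S independent = subst (_≤ suc t) (sym (∣∣≡size S))
    (halve-≤ (subst (size s + size s ≤_) ℓ≡ (no-consecutive-size s apart)))
    where
    s = Vec.lookup S
    apart : ∀ i → s i ≡ true → s (rot i) ≡ true → ⊥
    apart i si sri with () ← trans (sym (rot-adjacent (t + t) i))
      (independent i (rot i) (VecP.lookup⇒[]= i S si) (VecP.lookup⇒[]= (rot i) S sri))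
    ℓ≡ : 3 + (t + t) ≡ suc (suc t + suc t)
    ℓ≡ = cong (λ x → suc (suc x)) (sym (ℕP.+-suc t t))

  -- The density of a subgraph of C_{k+3} on a vertex set s with at least three
  -- vertices is at most (k+2)/(k+1): if s is everything the subgraph has at most
  -- k + 3 edges, otherwise it has fewer edges than vertices.
  cycle-subgraph-density≤ : ∀ k (s : VSet (3 + k)) e → 3 ≤ size s → e ≤ consecutive s →
    frac (+ e ℤ.- + 1) (size s ∸ 2) ℚ.≤ cycleRatio k
  cycle-subgraph-density≤ k s e three e≤ with FinP.all? (λ i → s i ≟ᵇ true)
  ... | yes spanning = subst (λ v → frac (+ e ℤ.- + 1) (v ∸ 2) ℚ.≤ cycleRatio k) (sym size≡ℓ)
        (spanning-density≤ k e (ℕP.≤-trans e≤ (ℕP.≤-trans (consecutive≤size s) (ℕP.≤-reflexive size≡ℓ))))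
    where
    size≡ℓ : size s ≡ 3 + k
    size≡ℓ = trans (sum-cong-≗ (λ i → cong 𝟙 (spanning i))) (size-full (3 + k))
  ... | no not-spanning with size-nonempty s (ℕP.<-≤-trans (s≤s z≤n) three)
                           | FinP.¬∀⟶∃¬ (3 + k) (λ i → s i ≡ true) (λ i → s i ≟ᵇ true) not-spanning
  ...   | i₀ , si₀ | j , sj≢true =
    forest-density≤ k (size s) e three (size≤n s) (ℕP.≤-<-trans e≤ (consecutive<size s i₀ si₀ j (¬-not sj≢true)))

  cycle-m₂ : ∀ k → IsM2 (Cycle (3 + k)) (cycleRatio k)
  cycle-m₂ k = (whole , three , whole-density) , upper
    where
    ℓ = 3 + k
    whole = inducedSubgraph (Cycle ℓ) (λ _ → true)
    three : 3 ≤ ∣ verts whole ∣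
    three = subst (3 ≤_) (sym (trans (∣tabulate∣ {ℓ} (λ _ → true)) (size-full ℓ))) (s≤s (s≤s (s≤s z≤n)))
    whole-density : density whole ≡ cycleRatio k
    whole-density = trans (density-induced (Cycle ℓ) (λ _ → true))
      (cong₂ (λ e v → frac (+ e ℤ.- + 1) (v ∸ 2)) (trans (cycle-edges k (λ _ → true)) (size-full ℓ)) (size-full ℓ))
    upper : ∀ H′ → 3 ≤ ∣ verts H′ ∣ → density H′ ℚ.≤ cycleRatio k
    upper H′ three = subst (λ v → frac (+ edgeCount (sub H′) ℤ.- + 1) (v ∸ 2) ℚ.≤ cycleRatio k) (sym ∣S∣≡)
      (cycle-subgraph-density≤ k s (edgeCount (sub H′)) (subst (3 ≤_) ∣S∣≡ three)
        (ℕP.≤-trans (subgraph-edges≤ H′) (ℕP.≤-reflexive (cycle-edges k s))))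
      where
      s = Vec.lookup (verts H′)
      ∣S∣≡ : ∣ verts H′ ∣ ≡ size s
      ∣S∣≡ = ∣∣≡size (verts H′)

  -- Every graph H on 2t + 3 vertices with α(H) ≤ t + 1 has m₂(H) ≥ (2t+2)/(2t+1):
  -- an independent set of size ≥ (2t+3)/2 is excluded, so by the greedy lemma H
  -- has a vertex set T spanning at least |T| ≥ 3 edges, whose density is large.
  m₂-lower : ∀ t (H : Graph (3 + (t + t))) → AlphaAtMost H (suc t) →
    ∀ q → IsM2 H q → cycleRatio (t + t) ℚ.≤ q
  m₂-lower t H α q (_ , maximal) with Greedy.greedy H ℓ (λ _ → true) (ℕP.≤-reflexive (size-full ℓ))
    where ℓ = 3 + (t + t)
  ... | inj₂ (I , stable , _ , large) = ⊥-elim (ℕP.1+n≰n (begin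
    3 + (t + t)            ≡⟨ sym (size-full (3 + (t + t))) ⟩
    size {3 + (t + t)} (λ _ → true) ≤⟨ large ⟩
    size I + size I        ≤⟨ ℕP.+-mono-≤ (stable-size≤ H α I stable) (stable-size≤ H α I stable) ⟩
    suc t + suc t          ≡⟨ cong suc (ℕP.+-suc t t) ⟩
    2 + (t + t)            ∎))
    where open ℕP.≤-Reasoning
  ... | inj₁ (T , three , dense) = ℚP.≤-trans
    (subst (cycleRatio (t + t) ℚ.≤_) (sym (density-induced H T))
      (dense-density≥ (t + t) (size T) (edges (adj (induced H T))) three (size≤n T) dense))
    (maximal (inducedSubgraph H T) (subst (3 ≤_) (sym (∣tabulate∣ T)) three))

  -- The theorem for r = t + 2, where ℓ = 2t + 3 and ℓ - 2 = 2t + 1.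
  odd-cycle-M : ∀ t → IsM (3 + (t + t)) (2 + t) (1ℚ ℚ.+ frac (+ 1) (suc (t + t))) ×
                      IsM2 (Cycle (3 + (t + t))) (1ℚ ℚ.+ frac (+ 1) (suc (t + t)))
  odd-cycle-M t rewrite 1+1/[k+1]≡cycleRatio (t + t) =
    ((Cycle (3 + (t + t)) , cycle-α t , cycle-m₂ (t + t)) , m₂-lower t) , cycle-m₂ (t + t)

  2r≡2t+4 : ∀ t → 2 * (2 + t) ≡ 4 + (t + t)
  2r≡2t+4 = solve-∀


open OddCycles using (odd-cycle-M; 2r≡2t+4)
open import Data.Nat using (ℕ; _≤_; _*_; _∸_; zero; suc; s≤s)
open import Data.Integer using (+_)
open import Data.Rational using (1ℚ; _+_)
open import Data.Product using (_×_)
open import Relation.Binary.PropositionalEquality using (sym; cong; subst₂)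

proposition3p1 : (r : ℕ) → 2 ≤ r →
    IsM (2 * r ∸ 1) r (1ℚ + frac (+ 1) (2 * r ∸ 3)) ×
    IsM2 (Cycle (2 * r ∸ 1)) (1ℚ + frac (+ 1) (2 * r ∸ 3))
proposition3p1 (suc zero) (s≤s ())
proposition3p1 r@(suc (suc t)) _ =
  subst₂ (λ ℓ d → IsM ℓ r (1ℚ + frac (+ 1) d) × IsM2 (Cycle ℓ) (1ℚ + frac (+ 1) d))
    (cong (_∸ 1) (sym (2r≡2t+4 t))) (cong (_∸ 3) (sym (2r≡2t+4 t))) (odd-cycle-M t)
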